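{- For any connected finite simple graph $G$ of order $n \ge 2$ and any integer $p$ with $1 \le p < n$, $$\left\lceil \frac{n+p}{2}\right\rceil \le \gamma(M(G+\overline{K_p})) \le n.$$
   Context: $\overline{K_p}$ denotes the edgeless graph on $p$ vertices. The join $G+H$ of graphs with disjoint vertex sets has vertex set $V(G)\cup V(H)$ and edge set $E(G)\cup E(H)\cup\{vw : v\in V(G), w\in V(H)\}$. For a finite simple graph $H$, the middle graph $M(H)$ is the graph with vertex set $V(H)\cup E(H)$ in which two elements $x,y$ are adjacent if and only if either (1) $x,y\in E(H)$ and the edges $x,y$ share a common endpoint in $H$, or (2) $x\in V(H)$, $y\in E(H)$ and $x$ is an endpoint of $y$ (or vice versa). A dominating set of a graph $H$ is a set $S\subseteq V(H)$ such that every vertex of $H$ is in $S$ or adjacent to a vertex of $S$; the domination number $\gamma(H)$ is the minimum cardinality of a dominating set of $H$. -}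

module Defs where

open import Data.Nat using (ℕ; suc; _+_; _≤_)
open import Data.Fin using (Fin; _<_; splitAt)
open import Data.Bool using (Bool; true; false; T)
open import Data.Sum using (_⊎_; inj₁; inj₂)
open import Data.Product using (Σ; ∃; _×_; _,_; proj₁; proj₂)
open import Data.Empty using (⊥)
open import Data.List using (List; length)
open import Data.List.Membership.Propositional using (_∈_)
open import Data.List.Relation.Unary.Unique.Propositional using (Unique)
open import Relation.Binary.PropositionalEquality using (_≡_; _≢_)

record Graph (n : ℕ) : Set where
  field
    adj    : Fin n → Fin n → Bool
    sym    : ∀ u v → adj u v ≡ adj v u
    irrefl : ∀ v → adj v v ≡ false
open Graph public

Adj : ∀ {n} → Graph n → Fin n → Fin n → Set
Adj G u v = T (adj G u v)

data Walk {n} (G : Graph n) : Fin n → Fin n → Set where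
  here : ∀ {v} → Walk G v v
  step : ∀ {u v w} → Adj G u v → Walk G v w → Walk G u w

Connected : ∀ {n} → Graph n → Set
Connected G = ∀ u v → Walk G u v

edgeless : (p : ℕ) → Graph p
edgeless p = record { adj = λ _ _ → false ; sym = λ _ _ → _≡_.refl ; irrefl = λ _ → _≡_.refl }

-- join G + H: vertices of G are Fin n embedded first, then those of H
joinAdj : ∀ {n m} → Graph n → Graph m → Fin (n + m) → Fin (n + m) → Bool
joinAdj {n} {m} G H x y with splitAt n x | splitAt n y
... | inj₁ a | inj₁ b = adj G a b
... | inj₂ a | inj₂ b = adj H a b
... | inj₁ _ | inj₂ _ = true
... | inj₂ _ | inj₁ _ = true

joinSym : ∀ {n m} (G : Graph n) (H : Graph m) x y → joinAdj G H x y ≡ joinAdj G H y x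
joinSym {n} G H x y with splitAt n x | splitAt n y
... | inj₁ a | inj₁ b = sym G a b
... | inj₂ a | inj₂ b = sym H a b
... | inj₁ _ | inj₂ _ = _≡_.refl
... | inj₂ _ | inj₁ _ = _≡_.refl

joinIrr : ∀ {n m} (G : Graph n) (H : Graph m) x → joinAdj G H x x ≡ false
joinIrr {n} G H x with splitAt n x
... | inj₁ a = irrefl G a
... | inj₂ a = irrefl H a

_⊕_ : ∀ {n m} → Graph n → Graph m → Graph (n + m)
G ⊕ H = record { adj = joinAdj G H ; sym = joinSym G H ; irrefl = joinIrr G H }

-- edges of G: unordered pairs {u,v} represented by u < v
Edge : ∀ {n} → Graph n → Set
Edge {n} G = Σ (Fin n × Fin n) λ uv → (proj₁ uv < proj₂ uv) × Adj G (proj₁ uv) (proj₂ uv)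

Endpoint : ∀ {n} {G : Graph n} → Fin n → Edge G → Set
Endpoint x ((u , v) , _) = (x ≡ u) ⊎ (x ≡ v)

record RGraph : Set₁ where
  field
    Vtx : Set
    _~_ : Vtx → Vtx → Set
open RGraph public

MAdj : ∀ {n} (G : Graph n) → (Fin n ⊎ Edge G) → (Fin n ⊎ Edge G) → Set
MAdj G (inj₁ x) (inj₁ y) = ⊥
MAdj G (inj₁ x) (inj₂ e) = Endpoint {G = G} x e
MAdj G (inj₂ e) (inj₁ x) = Endpoint {G = G} x e
MAdj G (inj₂ e) (inj₂ f) = (e ≢ f) × ∃ λ x → Endpoint {G = G} x e × Endpoint {G = G} x f

Middle : ∀ {n} → Graph n → RGraph
Middle G = record { Vtx = Fin _ ⊎ Edge G ; _~_ = MAdj G }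

Dominating : (H : RGraph) → List (Vtx H) → Set
Dominating H S = ∀ v → (v ∈ S) ⊎ (∃ λ w → (w ∈ S) × (_~_ H v w ⊎ _~_ H w v))

IsDominationNumber : RGraph → ℕ → Set
IsDominationNumber H k =
  (∃ λ S → Unique S × Dominating H S × length S ≡ k) ×
  (∀ S → Unique S → Dominating H S → k ≤ length S)

module Submission where

-- For H = G + K̄_p (n vertices in G, 1 ≤ p < n) we prove
--   ⌈(n + p)/2⌉ ≤ γ(M(H)) ≤ n.
--
-- Lower bound: each element of M(H) dominates at most two vertices of H
--    (a vertex itself, or the two endpoints of an edge), so every dominating
--    set has at least ⌈N/2⌉ elements.  Upper bound: the edges of any edge
--    cover of H form a dominating set of M(H).
-- 3. The join G + K̄_p has an edge cover with n edges: join each vertex a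
--    of G to the vertex (a mod p) of K̄_p.

open import Data.Nat using (ℕ; NonZero; >-nonZero; _<_; _≤_; _+_; _*_; z≤n; s≤s; ⌈_/2⌉)
open import Data.Nat.Properties
  using (≤-refl; ≤-trans; <-≤-trans; <⇒≤; m≤m+n; +-mono-≤; *-comm; +-identityʳ;
         ⌈n/2⌉-mono; n≡⌈n+n/2⌉; module ≤-Reasoning)
open import Data.Nat.DivMod using (_mod_; _%_; m<n⇒m%n≡m)
open import Data.Fin as F using (Fin; zero; suc; toℕ; inject≤; _↑ˡ_; _↑ʳ_; splitAt)
open import Data.Fin.Properties
  using (<-irrelevant; any?; injective⇒≤; toℕ<n; toℕ-injective; toℕ-fromℕ<; toℕ-inject≤;
         toℕ-↑ˡ; toℕ-↑ʳ; splitAt-↑ˡ; splitAt-↑ʳ; splitAt⁻¹-↑ˡ; splitAt⁻¹-↑ʳ)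
open import Data.Bool using (true; false)
open import Data.Bool.Properties using (T-irrelevant)
open import Data.Unit using (tt)
open import Data.Empty using (⊥-elim)
open import Data.Product using (∃; _×_; _,_; proj₁; proj₂)
open import Data.Product.Properties using () renaming (≡-dec to ×-≡-dec)
open import Data.Sum using (_⊎_; inj₁; inj₂)
open import Data.Sum.Properties using () renaming (≡-dec to ⊎-≡-dec)
open import Data.List using (List; []; _∷_; _++_; concatMap; allFin; length; lookup; map; filter; deduplicate)
open import Data.List.Properties using (length-++; length-map; length-tabulate)
open import Data.List.Relation.Unary.Any as Any using (here; there; index)
open import Data.List.Relation.Unary.Any.Properties using (lookup-index)
open import Data.List.Relation.Unary.All as All using (All)
open import Data.List.Relation.Unary.AllPairs using (_∷_)
open import Data.List.Membership.Propositional using (_∈_; lose; find)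
open import Data.List.Membership.Propositional.Properties
  using (∈-lookup; ∈-allFin; ∈-concatMap⁺; ∈-++⁺ˡ; ∈-++⁺ʳ; ∈-map⁺; ∈-map⁻; ∈-filter⁺; ∈-filter⁻;
         ∈-deduplicate⁺; ∈-deduplicate⁻)
import Data.List.Membership.DecPropositional as DecMembership
open import Data.List.Relation.Binary.Subset.Propositional using (_⊆_)
open import Data.List.Relation.Unary.Unique.Propositional using (Unique)
open import Data.List.Relation.Unary.Unique.Propositional.Properties using (allFin⁺)
open import Data.List.Relation.Unary.Unique.DecPropositional.Properties using (deduplicate-!)
open import Data.List.Extrema.Nat using (argmin; argmin-all; f[argmin]≤v⁺)
open import Function.Base using (id)
open import Relation.Binary.Definitions using (DecidableEquality)
open import Relation.Binary.PropositionalEquality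
  using (_≡_; refl; sym; trans; cong; subst; module ≡-Reasoning)
open import Relation.Nullary using (Dec; yes; no; does; ¬?)
open import Relation.Nullary.Decidable using (map′; _×-dec_; _⊎-dec_; T?)
open import Relation.Unary using (Decidable)
open import Defs
  using (Graph; adj; Adj; Connected; edgeless; _⊕_; Edge; Endpoint; MAdj; Middle;
         Dominating; IsDominationNumber)

lookup-injective : ∀ {A : Set} {xs : List A} → Unique xs →
                   ∀ i j → lookup xs i ≡ lookup xs j → i ≡ j
lookup-injective (_ ∷ _)    zero    zero    _  = refl
lookup-injective (x∉ ∷ _)   zero    (suc j) eq = ⊥-elim (All.lookup x∉ (∈-lookup j) eq)
lookup-injective (x∉ ∷ _)   (suc i) zero    eq = ⊥-elim (All.lookup x∉ (∈-lookup i) (sym eq))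
lookup-injective (_ ∷ xs!)  (suc i) (suc j) eq = cong suc (lookup-injective xs! i j eq)

-- A duplicate-free list is no longer than any list containing all its
-- elements: sending each position of xs to a position of the same element in
-- ys is injective.
unique-⊆⇒length-≤ : ∀ {A : Set} {xs ys : List A} → Unique xs → xs ⊆ ys →
                    length xs ≤ length ys
unique-⊆⇒length-≤ {xs = xs} {ys} xs! xs⊆ys = injective⇒≤ position-injective
  where
  position : Fin (length xs) → Fin (length ys)
  position i = index (xs⊆ys (∈-lookup i))

  same-element : ∀ i → lookup ys (position i) ≡ lookup xs i
  same-element i = sym (lookup-index (xs⊆ys (∈-lookup i)))

  position-injective : ∀ {i j} → position i ≡ position j → i ≡ j
  position-injective {i} {j} eq = lookup-injective xs! i j
    (trans (sym (same-element i)) (trans (cong (lookup ys) eq) (same-element j)))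

length-concatMap-≤ : ∀ {A B : Set} (f : A → List B) {k} → (∀ x → length (f x) ≤ k) →
                     ∀ xs → length (concatMap f xs) ≤ length xs * k
length-concatMap-≤ f bound []       = z≤n
length-concatMap-≤ f bound (x ∷ xs) = begin
  length (f x ++ concatMap f xs)         ≡⟨ length-++ (f x) ⟩
  length (f x) + length (concatMap f xs) ≤⟨ +-mono-≤ (bound x) (length-concatMap-≤ f bound xs) ⟩
  _                                       ∎
  where open ≤-Reasoning

⌈/2⌉-≤ : ∀ {m s} → m ≤ s * 2 → ⌈ m /2⌉ ≤ s
⌈/2⌉-≤ {m} {s} m≤2s = begin
  ⌈ m /2⌉           ≤⟨ ⌈n/2⌉-mono m≤2s ⟩
  ⌈ s * 2 /2⌉       ≡⟨ cong ⌈_/2⌉ (*-comm s 2) ⟩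
  ⌈ s + (s + 0) /2⌉ ≡⟨ cong (λ t → ⌈ s + t /2⌉) (+-identityʳ s) ⟩
  ⌈ s + s /2⌉       ≡⟨ sym (n≡⌈n+n/2⌉ s) ⟩
  s                 ∎
  where open ≤-Reasoning

sublists : ∀ {A : Set} → List A → List (List A)
sublists []       = [] ∷ []
sublists (x ∷ xs) = sublists xs ++ map (x ∷_) (sublists xs)

filter∈sublists : ∀ {A : Set} {P : A → Set} (P? : Decidable P) xs → filter P? xs ∈ sublists xs
filter∈sublists P? []       = here refl
filter∈sublists P? (x ∷ xs) with does (P? x)
... | true  = ∈-++⁺ʳ (sublists xs) (∈-map⁺ (x ∷_) (filter∈sublists P? xs))
... | false = ∈-++⁺ˡ (filter∈sublists P? xs)

-- Every list S can be replaced by its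
-- "trim" (the duplicate-free list of the same elements, no longer than S),
-- and all trims lie in a fixed finite pool built from the sublists of an
-- enumeration of A; so minimising length over the pool finds the least size.
module MinimumSize {A : Set} (_≟_ : DecidableEquality A)
                   (elements : List A) (complete : ∀ x → x ∈ elements)
                   (D : List A → Set) (D? : Decidable D)
                   (upward : ∀ {S T} → S ⊆ T → D S → D T) where

  open DecMembership _≟_ using (_∈?_)

  trim : List A → List A
  trim S = deduplicate _≟_ (filter (_∈? S) elements)

  trim-unique : ∀ S → Unique (trim S)
  trim-unique S = deduplicate-! _≟_ _

  ⊆-trim : ∀ S → S ⊆ trim S
  ⊆-trim S x∈S = ∈-deduplicate⁺ _≟_ (∈-filter⁺ (_∈? S) (complete _) x∈S)

  trim-⊆ : ∀ S → trim S ⊆ S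
  trim-⊆ S x∈ = proj₂ (∈-filter⁻ (_∈? S) {xs = elements} (∈-deduplicate⁻ _≟_ _ x∈))

  length-trim : ∀ S → length (trim S) ≤ length S
  length-trim S = unique-⊆⇒length-≤ (trim-unique S) (trim-⊆ S)

  candidates : List (List A)
  candidates = filter D? (map (deduplicate _≟_) (sublists elements))

  trim∈candidates : ∀ S → D S → trim S ∈ candidates
  trim∈candidates S dS =
    ∈-filter⁺ D? (∈-map⁺ (deduplicate _≟_) (filter∈sublists (_∈? S) elements)) (upward (⊆-trim S) dS)

  minimum-size : ∀ S₀ → D S₀ →
    ∃ λ k → (∃ λ S → Unique S × D S × length S ≡ k) × (∀ S → D S → k ≤ length S)
  minimum-size S₀ dS₀ = length best , (best , proj₁ best-good , proj₂ best-good , refl) , best-minimal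
    where
    best : List A
    best = argmin length (trim S₀) candidates

    Good : List A → Set
    Good S = Unique S × D S

    best-good : Good best
    best-good = argmin-all length (trim-unique S₀ , upward (⊆-trim S₀) dS₀) (All.tabulate candidate-good)
      where
      candidate-good : ∀ {S} → S ∈ candidates → Good S
      candidate-good S∈ with ∈-filter⁻ D? {xs = map (deduplicate _≟_) (sublists elements)} S∈
      ... | S∈dedups , dS with ∈-map⁻ (deduplicate _≟_) S∈dedups
      ...   | c , _ , refl = deduplicate-! _≟_ c , dS

    best-minimal : ∀ S → D S → length best ≤ length S
    best-minimal S dS = ≤-trans
      (f[argmin]≤v⁺ {f = length} (trim S₀) candidates (inj₂ (lose (trim∈candidates S dS) ≤-refl)))
      (length-trim S)

module MiddleGraph {N : ℕ} (H : Graph N) where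

  Element : Set
  Element = Fin N ⊎ Edge H

  -- An edge is determined by its endpoints: the proofs of u < v and of
  -- adjacency are proof-irrelevant.
  edge-ext : (e f : Edge H) → proj₁ e ≡ proj₁ f → e ≡ f
  edge-ext (uv , lt , a) (.uv , lt′ , a′) refl
    rewrite <-irrelevant lt lt′ | T-irrelevant a a′ = refl

  _≟ᴱ_ : DecidableEquality (Edge H)
  e ≟ᴱ f = map′ (edge-ext e f) (cong proj₁) (×-≡-dec F._≟_ F._≟_ (proj₁ e) (proj₁ f))

  _≟ᴹ_ : DecidableEquality Element
  _≟ᴹ_ = ⊎-≡-dec F._≟_ _≟ᴱ_

  edgesBetween : Fin N → Fin N → List (Edge H)
  edgesBetween u v with (u F.<? v) ×-dec T? (adj H u v)
  ... | yes uv = ((u , v) , uv) ∷ []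
  ... | no _   = []

  edgesBetween-complete : ∀ (e : Edge H) → e ∈ edgesBetween (proj₁ (proj₁ e)) (proj₂ (proj₁ e))
  edgesBetween-complete e@((u , v) , uv) with (u F.<? v) ×-dec T? (adj H u v)
  ... | yes uv′ = here (edge-ext e _ refl)
  ... | no ¬uv  = ⊥-elim (¬uv uv)

  allEdges : List (Edge H)
  allEdges = concatMap (λ u → concatMap (edgesBetween u) (allFin N)) (allFin N)

  allEdges-complete : ∀ e → e ∈ allEdges
  allEdges-complete e@((u , v) , _) =
    ∈-concatMap⁺ (λ u → concatMap (edgesBetween u) (allFin N))
      (lose (∈-allFin u) (∈-concatMap⁺ (edgesBetween u) (lose (∈-allFin v) (edgesBetween-complete e))))

  allElements : List Element
  allElements = map inj₁ (allFin N) ++ map inj₂ allEdges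

  allElements-complete : ∀ x → x ∈ allElements
  allElements-complete (inj₁ v) = ∈-++⁺ˡ (∈-map⁺ inj₁ (∈-allFin v))
  allElements-complete (inj₂ e) = ∈-++⁺ʳ _ (∈-map⁺ inj₂ (allEdges-complete e))

  endpoint? : ∀ x (e : Edge H) → Dec (Endpoint {G = H} x e)
  endpoint? x ((u , v) , _) = (x F.≟ u) ⊎-dec (x F.≟ v)

  adjacent? : ∀ x y → Dec (MAdj H x y)
  adjacent? (inj₁ x) (inj₁ y) = no λ ()
  adjacent? (inj₁ x) (inj₂ e) = endpoint? x e
  adjacent? (inj₂ e) (inj₁ x) = endpoint? x e
  adjacent? (inj₂ e) (inj₂ f) = ¬? (e ≟ᴱ f) ×-dec any? (λ x → endpoint? x e ×-dec endpoint? x f)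

  dominating? : Decidable (Dominating (Middle H))
  dominating? S = map′ (λ every x → All.lookup every (allElements-complete x))
                       (λ dom → All.tabulate λ {x} _ → dom x)
                       (All.all? dominated? allElements)
    where
    open DecMembership _≟ᴹ_ using (_∈?_)
    dominated? : ∀ x → Dec ((x ∈ S) ⊎ ∃ λ w → w ∈ S × (MAdj H x w ⊎ MAdj H w x))
    dominated? x = (x ∈? S) ⊎-dec map′ find (λ (w , w∈S , w~x) → lose w∈S w~x)
                                      (Any.any? (λ w → adjacent? x w ⊎-dec adjacent? w x) S)

  dominating-upward : ∀ {S T} → S ⊆ T → Dominating (Middle H) S → Dominating (Middle H) T
  dominating-upward S⊆T dom x with dom x
  ... | inj₁ x∈S            = inj₁ (S⊆T x∈S)
  ... | inj₂ (w , w∈S , w~x) = inj₂ (w , S⊆T w∈S , w~x)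

  open MinimumSize _≟ᴹ_ allElements allElements-complete (Dominating (Middle H)) dominating? dominating-upward
    using (minimum-size)

  domination-number : ∀ S₀ → Dominating (Middle H) S₀ →
    ∃ λ k → IsDominationNumber (Middle H) k × k ≤ length S₀
  domination-number S₀ dom₀ with minimum-size S₀ dom₀
  ... | k , realised , minimal = k , (realised , λ S _ dom → minimal S dom) , minimal S₀ dom₀

  coveredBy : Element → List (Fin N)
  coveredBy (inj₁ x)             = x ∷ []
  coveredBy (inj₂ ((u , v) , _)) = u ∷ v ∷ []

  length-coveredBy : ∀ x → length (coveredBy x) ≤ 2
  length-coveredBy (inj₁ _) = s≤s z≤n
  length-coveredBy (inj₂ _) = ≤-refl

  endpoint-coveredBy : ∀ {x} (e : Edge H) → Endpoint {G = H} x e → x ∈ coveredBy (inj₂ e)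
  endpoint-coveredBy _ (inj₁ refl) = here refl
  endpoint-coveredBy _ (inj₂ refl) = there (here refl)

  -- a dominating set of M(H) covers every vertex of H in this sense (a vertex
  -- of H is never adjacent to another vertex in M(H))
  dominating-covers : ∀ {S} → Dominating (Middle H) S → ∀ x → x ∈ concatMap coveredBy S
  dominating-covers dom x with dom (inj₁ x)
  ... | inj₁ x∈S                       = ∈-concatMap⁺ coveredBy (lose x∈S (here refl))
  ... | inj₂ (inj₂ e , e∈S , inj₁ x∈e) = ∈-concatMap⁺ coveredBy (lose e∈S (endpoint-coveredBy e x∈e))
  ... | inj₂ (inj₂ e , e∈S , inj₂ x∈e) = ∈-concatMap⁺ coveredBy (lose e∈S (endpoint-coveredBy e x∈e))

  dominating-size : ∀ S → Dominating (Middle H) S → N ≤ length S * 2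
  dominating-size S dom = begin
    N                              ≡⟨ sym (length-tabulate id) ⟩
    length (allFin N)              ≤⟨ unique-⊆⇒length-≤ (allFin⁺ N) (λ {x} _ → dominating-covers dom x) ⟩
    length (concatMap coveredBy S) ≤⟨ length-concatMap-≤ coveredBy length-coveredBy S ⟩
    length S * 2                   ∎
    where open ≤-Reasoning

  domination-number-≥ : ∀ {k} → IsDominationNumber (Middle H) k → ⌈ N /2⌉ ≤ k
  domination-number-≥ ((S , _ , dom , refl) , _) = ⌈/2⌉-≤ (dominating-size S dom)

  EdgeCover : List (Edge H) → Set
  EdgeCover T = ∀ x → ∃ λ e → e ∈ T × Endpoint {G = H} x e

  -- an edge cover dominates M(H): a vertex x is an endpoint of its covering
  -- edge, and an edge e = uv is either the covering edge of u or shares u with it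
  edgeCover-dominating : ∀ {T} → EdgeCover T → Dominating (Middle H) (map inj₂ T)
  edgeCover-dominating cover (inj₁ x) with cover x
  ... | e , e∈T , x∈e = inj₂ (inj₂ e , ∈-map⁺ inj₂ e∈T , inj₁ x∈e)
  edgeCover-dominating cover (inj₂ e@((u , _) , _)) with cover u
  ... | f , f∈T , u∈f with e ≟ᴱ f
  ...   | yes refl = inj₁ (∈-map⁺ inj₂ f∈T)
  ...   | no e≢f   = inj₂ (inj₂ f , ∈-map⁺ inj₂ f∈T , inj₁ (e≢f , u , inj₁ refl , u∈f))

module JoinWithEdgeless {n p : ℕ} (G : Graph n) .{{_ : NonZero p}} (p≤n : p ≤ n) where

  H : Graph (n + p)
  H = G ⊕ edgeless p

  open MiddleGraph H

  inG : Fin n → Fin (n + p)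
  inG a = a ↑ˡ p

  inK : Fin p → Fin (n + p)
  inK b = n ↑ʳ b

  spoke-ordered : ∀ a b → inG a F.< inK b
  spoke-ordered a b rewrite toℕ-↑ˡ a p | toℕ-↑ʳ n b = <-≤-trans (toℕ<n a) (m≤m+n n (toℕ b))

  spoke-adjacent : ∀ a b → Adj H (inG a) (inK b)
  spoke-adjacent a b rewrite splitAt-↑ˡ n a p | splitAt-↑ʳ n p b = tt

  spoke : Fin n → Fin p → Edge H
  spoke a b = (inG a , inK b) , spoke-ordered a b , spoke-adjacent a b

  -- the vertex of K̄_p that vertex a of G is joined to; every vertex b of
  -- K̄_p is the hub of the vertex of G with the same index (as p ≤ n)
  hub : Fin n → Fin p
  hub a = toℕ a mod p

  hub-inject≤ : ∀ b → hub (inject≤ b p≤n) ≡ b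
  hub-inject≤ b = toℕ-injective (begin
    toℕ (toℕ (inject≤ b p≤n) mod p) ≡⟨ toℕ-fromℕ< _ ⟩
    toℕ (inject≤ b p≤n) % p         ≡⟨ cong (_% p) (toℕ-inject≤ b p≤n) ⟩
    toℕ b % p                       ≡⟨ m<n⇒m%n≡m (toℕ<n b) ⟩
    toℕ b                           ∎)
    where open ≡-Reasoning

  spokes : List (Edge H)
  spokes = map (λ a → spoke a (hub a)) (allFin n)

  spoke∈spokes : ∀ a → spoke a (hub a) ∈ spokes
  spoke∈spokes a = ∈-map⁺ (λ a → spoke a (hub a)) (∈-allFin a)

  spokes-cover : EdgeCover spokes
  spokes-cover x with splitAt n x in eq
  ... | inj₁ a = spoke a (hub a) , spoke∈spokes a , inj₁ (sym (splitAt⁻¹-↑ˡ eq))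
  ... | inj₂ b = spoke a (hub a) , spoke∈spokes a ,
                 inj₂ (trans (sym (splitAt⁻¹-↑ʳ eq)) (cong inK (sym (hub-inject≤ b))))
    where a = inject≤ b p≤n

  length-spokes : length (map (inj₂ {A = Fin (n + p)}) spokes) ≡ n
  length-spokes = trans (length-map inj₂ spokes) (trans (length-map _ (allFin n)) (length-tabulate id))

  domination-number-≤ : ∃ λ k → IsDominationNumber (Middle H) k × k ≤ n
  domination-number-≤ with domination-number (map inj₂ spokes) (edgeCover-dominating spokes-cover)
  ... | k , γ , k≤size = k , γ , subst (k ≤_) length-spokes k≤size

theorem2p16 : (n : ℕ) → (G : Graph n) → 2 ≤ n → Connected G →
    (p : ℕ) → 1 ≤ p → p < n →
    ∃ λ k → IsDominationNumber (Middle (G ⊕ edgeless p)) k × ⌈ n + p /2⌉ ≤ k × k ≤ n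
theorem2p16 n G _ _ p 1≤p p<n =
  let (k , γ , k≤n) = domination-number-≤ in k , γ , domination-number-≥ γ , k≤n
  where
  open JoinWithEdgeless G {{>-nonZero 1≤p}} (<⇒≤ p<n)
  open MiddleGraph H using (domination-number-≥)
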